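{- Let $\mathcal{F} = \{F_1,\ldots,F_m\}$ be a hypergraph on a finite vertex set $V$ and let $\mathcal{S} = \bigcup_{i=1}^m dual(\mathcal{F}_i)$. A nonempty vertex subset $S \subseteq V$ belongs to $\mathcal{S}$ if and only if $min\_crit(v,S) < min\_uncov(S)$ holds for every $v \in S$.
   Context: A hypergraph is a finite family of subsets (hyperedges) of $V$; here the hyperedges are indexed $F_1,\ldots,F_m$. $\mathcal{F}_i = \{F_1,\ldots,F_i\}$. A hitting set of a hypergraph $\mathcal{G}$ is a set $H\subseteq V$ meeting every hyperedge of $\mathcal{G}$; it is minimal if no proper subset is a hitting set; $dual(\mathcal{G})$ is the set of all minimal hitting sets of $\mathcal{G}$. For $S \subseteq V$: $uncov(S) = \{F \in \mathcal{F} : F \cap S = \emptyset\}$, and for $v \in S$, $crit(v,S) = \{F \in \mathcal{F} : S \cap F = \{v\}\}$ (computed with respect to the full hypergraph $\mathcal{F}$). $min\_crit(v,S)$ is the minimum $i$ with $F_i \in crit(v,S)$, or $m+1$ if $crit(v,S)=\emptyset$; $min\_uncov(S)$ is the minimum $i$ with $F_i \in uncov(S)$, or $m+1$ if $uncov(S) = \emptyset$. -}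

module Defs where

open import Data.Nat using (ℕ; zero; suc; _<_)
open import Data.Fin using (Fin; toℕ) renaming (zero to fzero; suc to fsuc)
open import Data.Fin.Subset using (Subset; _∩_; ⁅_⁆; ⊥; Nonempty; _⊂_)
open import Data.Bool using (Bool; true; false)
import Data.Bool.Properties as BoolP
open import Data.Vec.Properties using (≡-dec)
open import Data.Product using (_×_)
open import Relation.Binary.PropositionalEquality using (_≡_)
open import Relation.Nullary using (¬_; Dec; yes; no)

-- A hypergraph F = {F_1,…,F_m} on V = Fin n is a function  F : Fin m → Subset n ;
-- the paper's hyperedge F_i (1 ≤ i ≤ m) is  F j  with  toℕ j = i - 1.

_≟S_ : ∀ {n} (p q : Subset n) → Dec (p ≡ q)
_≟S_ = ≡-dec BoolP._≟_

IsHittingSet : ∀ {n m} → (Fin m → Subset n) → ℕ → Subset n → Set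
IsHittingSet {m = m} F i H = (j : Fin m) → toℕ j < i → Nonempty (F j ∩ H)

InDual : ∀ {n m} → (Fin m → Subset n) → ℕ → Subset n → Set
InDual F i H = IsHittingSet F i H × (∀ H′ → H′ ⊂ H → ¬ IsHittingSet F i H′)

InUnionDual : ∀ {n m} → (Fin m → Subset n) → Subset n → Set
InUnionDual {m = m} F S = Data.Product.∃ λ (j : Fin m) → InDual F (suc (toℕ j)) S

-- least 1-based index i with P (F_i) true, or m+1 if none
firstIdx : ∀ {m} → (Fin m → Bool) → ℕ
firstIdx {zero} P = 1
firstIdx {suc m} P with P fzero
... | true = 1
... | false = suc (firstIdx (λ j → P (fsuc j)))

isCrit : ∀ {n} → Fin n → Subset n → Subset n → Bool
isCrit v S Fj with (S ∩ Fj) ≟S ⁅ v ⁆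
... | yes _ = true
... | no _ = false

isUncov : ∀ {n} → Subset n → Subset n → Bool
isUncov S Fj with (S ∩ Fj) ≟S ⊥
... | yes _ = true
... | no _ = false

min-crit : ∀ {n m} → (Fin m → Subset n) → Fin n → Subset n → ℕ
min-crit F v S = firstIdx (λ j → isCrit v S (F j))

min-uncov : ∀ {n m} → (Fin m → Subset n) → Subset n → ℕ
min-uncov F S = firstIdx (λ j → isUncov S (F j))

-- S hits 𝓕_i exactly when i < min-uncov S, and v ∈ S has a private hyperedge in 𝓕_i (one meeting
-- S in v alone) exactly when min-crit v S ≤ i. A hitting set is minimal iff each of its vertices
-- has a private hyperedge. Hence S ∈ dual(𝓕_i) gives min-crit v S ≤ i < min-uncov S; conversely
-- the condition makes S a minimal hitting set of 𝓕_i for i = min-uncov S - 1, and i ≥ 1 as S ≠ ∅.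
module Submission where

open import Defs
open import Data.Nat using (ℕ; zero; suc; _≤_; _<_; z≤n; s≤s)
open import Data.Nat.Properties using (≤-refl; ≤-trans; ≤-<-trans; ≤-pred; _<?_)
open import Data.Fin using (Fin; toℕ; fromℕ<; _≟_) renaming (zero to fzero; suc to fsuc)
open import Data.Fin.Properties using (toℕ<n; toℕ-fromℕ<; ¬∀⟶∃¬)
open import Data.Fin.Subset using (Subset; _∈_; _∉_; _∩_; _-_; ⁅_⁆; ⊥; _⊆_; _⊂_; Nonempty; Empty)
open import Data.Fin.Subset.Properties
  using (nonempty?; Empty-unique; ∉⊥; ∩-comm; x∈p∩q⁺; x∈p∩q⁻; x∈⁅x⁆; x∈⁅y⁆⇒x≡y; ⊆-antisym; x∈p∧x≢y⇒x∈p-y; x∈p⇒p-x⊂p)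
open import Data.Bool using (Bool; true; false)
open import Data.Product using (_×_; _,_; ∃-syntax)
open import Data.Empty using (⊥-elim)
open import Relation.Binary.PropositionalEquality using (_≡_; refl; sym; trans; subst; cong)
open import Relation.Nullary using (¬_; yes; no)
open import Relation.Nullary.Decidable using (_→-dec_)

firstIdx-suc : ∀ {m} (P : Fin m → Bool) → ∃[ i ] firstIdx P ≡ suc i
firstIdx-suc {zero}  P = 0 , refl
firstIdx-suc {suc m} P with P fzero
... | true  = 0 , refl
... | false = _ , refl

1≤firstIdx : ∀ {m} (P : Fin m → Bool) → 1 ≤ firstIdx P
1≤firstIdx P with firstIdx-suc P
... | _ , eq rewrite eq = s≤s z≤n

firstIdx≤1+m : ∀ {m} (P : Fin m → Bool) → firstIdx P ≤ suc m
firstIdx≤1+m {zero}  P = s≤s z≤n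
firstIdx≤1+m {suc m} P with P fzero
... | true  = s≤s z≤n
... | false = s≤s (firstIdx≤1+m (λ j → P (fsuc j)))

firstIdx≤ : ∀ {m} (P : Fin m → Bool) j → P j ≡ true → firstIdx P ≤ suc (toℕ j)
firstIdx≤ {suc m} P fzero    Pj with P fzero
firstIdx≤ {suc m} P fzero    refl | true = ≤-refl
firstIdx≤ {suc m} P (fsuc j) Pj with P fzero
... | true  = s≤s z≤n
... | false = s≤s (firstIdx≤ (λ j → P (fsuc j)) j Pj)

firstIdx-witness : ∀ {m} (P : Fin m → Bool) → firstIdx P ≤ m →
  ∃[ j ] P j ≡ true × suc (toℕ j) ≡ firstIdx P
firstIdx-witness {suc m} P le with P fzero in P₀
... | true  = fzero , P₀ , refl
... | false with firstIdx-witness (λ j → P (fsuc j)) (≤-pred le)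
...   | j , Pj , eq = fsuc j , Pj , cong suc eq

firstIdx-minimal : ∀ {m} (P : Fin m → Bool) j → suc (toℕ j) < firstIdx P → P j ≡ false
firstIdx-minimal {suc m} P j lt with P fzero in P₀
firstIdx-minimal {suc m} P j (s≤s ()) | true
firstIdx-minimal {suc m} P fzero    lt | false = P₀
firstIdx-minimal {suc m} P (fsuc j) lt | false = firstIdx-minimal (λ j → P (fsuc j)) j (≤-pred lt)

<firstIdx : ∀ {m} (P : Fin m → Bool) k → k ≤ m → (∀ j → toℕ j < k → P j ≡ false) → k < firstIdx P
<firstIdx P zero _ _ = 1≤firstIdx P
<firstIdx {suc m} P (suc k) (s≤s k≤m) none with P fzero in P₀
... | true with () ← trans (sym P₀) (none fzero (s≤s z≤n))
... | false = s≤s (<firstIdx (λ j → P (fsuc j)) k k≤m (λ j lt → none (fsuc j) (s≤s lt)))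

module _ {n : ℕ} where

  isCrit⇒≡⁅⁆ : ∀ (v : Fin n) S A → isCrit v S A ≡ true → S ∩ A ≡ ⁅ v ⁆
  isCrit⇒≡⁅⁆ v S A _ with (S ∩ A) ≟S ⁅ v ⁆
  isCrit⇒≡⁅⁆ v S A _  | yes eq = eq
  isCrit⇒≡⁅⁆ v S A () | no _

  ≡⁅⁆⇒isCrit : ∀ (v : Fin n) S A → S ∩ A ≡ ⁅ v ⁆ → isCrit v S A ≡ true
  ≡⁅⁆⇒isCrit v S A eq with (S ∩ A) ≟S ⁅ v ⁆
  ... | yes _  = refl
  ... | no neq = ⊥-elim (neq eq)

  isUncov≡false⇒Nonempty : ∀ (S A : Subset n) → isUncov S A ≡ false → Nonempty (A ∩ S)
  isUncov≡false⇒Nonempty S A _ with (S ∩ A) ≟S ⊥ | nonempty? (A ∩ S)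
  isUncov≡false⇒Nonempty S A () | yes _   | _
  ... | no _   | yes ne = ne
  ... | no neq | no ¬ne = ⊥-elim (neq (subst (_≡ ⊥) (∩-comm A S) (Empty-unique ¬ne)))

  Nonempty⇒isUncov≡false : ∀ (S A : Subset n) → Nonempty (A ∩ S) → isUncov S A ≡ false
  Nonempty⇒isUncov≡false S A (x , x∈A∩S) with (S ∩ A) ≟S ⊥
  ... | yes eq = ⊥-elim (∉⊥ (subst (x ∈_) (trans (∩-comm A S) eq) x∈A∩S))
  ... | no _   = refl

  ≡⁅⁆⇒Empty : ∀ {x : Fin n} {S A H} → S ∩ A ≡ ⁅ x ⁆ → H ⊆ S → x ∉ H → Empty (A ∩ H)
  ≡⁅⁆⇒Empty {x} {A = A} {H} eq H⊆S x∉H (y , y∈A∩H) with x∈p∩q⁻ A H y∈A∩H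
  ... | y∈A , y∈H with refl ← x∈⁅y⁆⇒x≡y x (subst (y ∈_) eq (x∈p∩q⁺ (H⊆S y∈H , y∈A))) = x∉H y∈H

  Empty-minus⇒≡⁅⁆ : ∀ {v : Fin n} {S A} → Nonempty (A ∩ S) → Empty (A ∩ (S - v)) → S ∩ A ≡ ⁅ v ⁆
  Empty-minus⇒≡⁅⁆ {v} {S} {A} (y , y∈A∩S) miss = ⊆-antisym ⊆⁅v⁆ ⁅v⁆⊆
    where
    only-v : ∀ {x} → x ∈ A → x ∈ S → x ≡ v
    only-v {x} x∈A x∈S with x ≟ v
    ... | yes x≡v = x≡v
    ... | no x≢v  = ⊥-elim (miss (x , x∈p∩q⁺ (x∈A , x∈p∧x≢y⇒x∈p-y x∈S x≢v)))

    ⊆⁅v⁆ : S ∩ A ⊆ ⁅ v ⁆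
    ⊆⁅v⁆ x∈S∩A with x∈p∩q⁻ S A x∈S∩A
    ... | x∈S , x∈A with refl ← only-v x∈A x∈S = x∈⁅x⁆ v

    ⁅v⁆⊆ : ⁅ v ⁆ ⊆ S ∩ A
    ⁅v⁆⊆ x∈⁅v⁆ with refl ← x∈⁅y⁆⇒x≡y v x∈⁅v⁆ with x∈p∩q⁻ A S y∈A∩S
    ... | y∈A , y∈S with refl ← only-v y∈A y∈S = x∈p∩q⁺ (y∈S , y∈A)

module _ {n m : ℕ} (F : Fin m → Subset n) where

  CritIn : ℕ → Fin n → Subset n → Set
  CritIn i v S = ∃[ j ] toℕ j < i × S ∩ F j ≡ ⁅ v ⁆

  ¬hitting⇒missed-edge : ∀ {i H} → ¬ IsHittingSet F i H → ∃[ j ] toℕ j < i × Empty (F j ∩ H)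
  ¬hitting⇒missed-edge {i} {H} ¬hit
    with ¬∀⟶∃¬ m _ (λ j → (toℕ j <? i) →-dec nonempty? (F j ∩ H)) ¬hit
  ... | j , ¬hits-j with toℕ j <? i
  ...   | yes j<i = j , j<i , λ ne → ¬hits-j (λ _ → ne)
  ...   | no j≮i  = ⊥-elim (¬hits-j (λ j<i → ⊥-elim (j≮i j<i)))

  minimal⇒crit : ∀ {i S} → IsHittingSet F i S → (∀ H → H ⊂ S → ¬ IsHittingSet F i H) →
    ∀ v → v ∈ S → CritIn i v S
  minimal⇒crit {S = S} hit minimal v v∈S with ¬hitting⇒missed-edge (minimal (S - v) (x∈p⇒p-x⊂p v∈S))
  ... | j , j<i , miss = j , j<i , Empty-minus⇒≡⁅⁆ (hit j j<i) miss

  crit⇒minimal : ∀ {i S} → (∀ v → v ∈ S → CritIn i v S) → ∀ H → H ⊂ S → ¬ IsHittingSet F i H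
  crit⇒minimal crit H (H⊆S , x , x∈S , x∉H) hitH with crit x x∈S
  ... | j , j<i , eq = ≡⁅⁆⇒Empty eq H⊆S x∉H (hitH j j<i)

  hitting⇒<min-uncov : ∀ {i S} → i ≤ m → IsHittingSet F i S → i < min-uncov F S
  hitting⇒<min-uncov {i} {S} i≤m hit =
    <firstIdx _ i i≤m (λ j j<i → Nonempty⇒isUncov≡false S (F j) (hit j j<i))

  <min-uncov⇒hitting : ∀ {i S} → i < min-uncov F S → IsHittingSet F i S
  <min-uncov⇒hitting {S = S} i<u j j<i =
    isUncov≡false⇒Nonempty S (F j) (firstIdx-minimal _ j (≤-<-trans j<i i<u))

  crit⇒min-crit≤ : ∀ {i v S} → CritIn i v S → min-crit F v S ≤ i
  crit⇒min-crit≤ {v = v} {S} (j , j<i , eq) = ≤-trans (firstIdx≤ _ j (≡⁅⁆⇒isCrit v S (F j) eq)) j<i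

  min-crit≤⇒crit : ∀ {i v S} → i ≤ m → min-crit F v S ≤ i → CritIn i v S
  min-crit≤⇒crit {i} {v} {S} i≤m c≤i with firstIdx-witness _ (≤-trans c≤i i≤m)
  ... | j , Pj , eq = j , subst (_≤ i) (sym eq) c≤i , isCrit⇒≡⁅⁆ v S (F j) Pj

  InDual⇒InUnionDual : ∀ {i S} → 1 ≤ i → i ≤ m → InDual F i S → InUnionDual F S
  InDual⇒InUnionDual {suc t} {S} (s≤s z≤n) t<m dual =
    fromℕ< t<m , subst (λ k → InDual F (suc k) S) (sym (toℕ-fromℕ< t<m)) dual

lemma6 : (n m : ℕ) (F : Fin m → Subset n) (S : Subset n) → Nonempty S →
    (InUnionDual F S → ∀ v → v ∈ S → min-crit F v S < min-uncov F S)
    × ((∀ v → v ∈ S → min-crit F v S < min-uncov F S) → InUnionDual F S)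
lemma6 n m F S (v₀ , v₀∈S) = forward , backward
  where
  forward : InUnionDual F S → ∀ v → v ∈ S → min-crit F v S < min-uncov F S
  forward (j , hit , minimal) v v∈S =
    ≤-<-trans (crit⇒min-crit≤ F (minimal⇒crit F hit minimal v v∈S)) (hitting⇒<min-uncov F (toℕ<n j) hit)

  backward : (∀ v → v ∈ S → min-crit F v S < min-uncov F S) → InUnionDual F S
  backward crit<uncov with firstIdx-suc (λ j → isUncov S (F j))
  ... | i , u≡1+i = InDual⇒InUnionDual F 1≤i i≤m
                      (<min-uncov⇒hitting F i<u , crit⇒minimal F (λ v v∈S → min-crit≤⇒crit F i≤m (crit≤i v v∈S)))
    where
    i<u : i < min-uncov F S
    i<u = subst (i <_) (sym u≡1+i) ≤-refl

    i≤m : i ≤ m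
    i≤m = ≤-pred (subst (_≤ suc m) u≡1+i (firstIdx≤1+m _))

    crit≤i : ∀ v → v ∈ S → min-crit F v S ≤ i
    crit≤i v v∈S = ≤-pred (subst (min-crit F v S <_) u≡1+i (crit<uncov v v∈S))

    1≤i : 1 ≤ i
    1≤i = ≤-trans (1≤firstIdx (λ j → isCrit v₀ S (F j))) (crit≤i v₀ v₀∈S)
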